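{- Let $A_4=\{n\in\mathbb{Z}: 0<n<9999,\ n\neq 1111\,s,\ s=0,\dots,9\}$, each element written with four decimal digits (leading zeros allowed). For $n\in A_4$ let $(a_0\,b_0\,c_0\,d_0)$ be its digits arranged so that $a_0\ge b_0\ge c_0\ge d_0$, and define its parameters $p(n)=(\alpha,\beta)$ with $\alpha=a_0-d_0$, $\beta=b_0-c_0$ (so $0<\alpha\le 9$, $0\le\beta\le\alpha$). Let $K(n)=X-Y$ where $X=(a_0\,b_0\,c_0\,d_0)$ and $Y=(d_0\,c_0\,b_0\,a_0)$. Let $n\in A_4$ with $p(n)=(\alpha,\beta)$ and write $p(K(n))=(\alpha',\beta')$. Then: If $\beta\ge 1$: (K1) if $\alpha\ge\beta+1$ and $\beta\ge5$, then $(\alpha',\beta')=(2\alpha-10,\,2\beta-10)$; (K2) if $\alpha\ge6$, $\beta\le5$, $\alpha+\beta\ge11$, then $(\alpha',\beta')=(2\alpha-10,\,10-2\beta)$; (K5) if $\alpha\ge5$, $\alpha+\beta\le9$, then $(\alpha',\beta')=(10-2\beta,\,2\alpha-10)$; (K6) if $\alpha\le5$, $\alpha\ge\beta+1$, then $(\alpha',\beta')=(10-2\beta,\,10-2\alpha)$; (K9) if $\alpha\le\beta+1$, $\alpha+\beta\ge11$, then $(\alpha',\beta')=(\alpha+\beta-9,\,\alpha+\beta-11)$; (K10) if $\alpha\ge5$, $\beta\ge5$, $\alpha+\beta\le11$, then $(\alpha',\beta')=(\alpha+\beta-9,\,11-\alpha-\beta)$; (K13) if $\alpha\le5$, $\beta\le5$,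 $\alpha+\beta\ge9$, then $(\alpha',\beta')=(11-\alpha-\beta,\,\alpha+\beta-9)$; (K14) if $\beta\le\alpha\le\beta+1$, $\alpha+\beta\le9$, then $(\alpha',\beta')=(11-\alpha-\beta,\,9-\alpha-\beta)$; (K17) if $\alpha\ge\beta+1$, $9\le\alpha+\beta\le11$, then $(\alpha',\beta')=(\alpha-\beta+1,\,\alpha-\beta-1)$; (K18) if $\alpha\ge5$, $\beta\le5$, $\beta\le\alpha\le\beta+1$, then $(\alpha',\beta')=(\alpha-\beta+1,\,1-\alpha+\beta)$; (K21) if $\alpha=\beta=5$, then $(\alpha',\beta')=(1-\alpha+\beta,\,\alpha-\beta+1)$. If $\beta=0$: (K25) if $6\le\alpha\le9$, then $(\alpha',\beta')=(\alpha-1,\,10-\alpha)$; (K26) if $0<\alpha\le5$, then $(\alpha',\beta')=(10-\alpha,\,\alpha-1)$.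
   Context: $(a\,b\,c\,d)$ denotes $a\cdot10^3+b\cdot10^2+c\cdot10+d$. The parameters of $K(n)$ are computed from $K(n)$ (written with four digits, leading zeros allowed) in the same way as for $n$. -}

module Defs where

open import Data.Nat using (ℕ; zero; suc; _+_; _*_; _∸_; _≤_; _<_)
open import Data.Nat.DivMod using (_/_; _%_)
open import Data.Nat.Properties using (≤-decTotalOrder)
open import Data.List using (List; []; _∷_)
open import Data.Product using (_×_; _,_; proj₁; proj₂)
open import Relation.Binary.PropositionalEquality using (_≡_; _≢_)
open import Data.List.Sort.InsertionSort ≤-decTotalOrder using (sort)

digits→ℕ : ℕ → ℕ → ℕ → ℕ → ℕ
digits→ℕ a b c d = a * 1000 + b * 100 + c * 10 + d

digitList : ℕ → List ℕ
digitList n = (n / 1000) % 10 ∷ (n / 100) % 10 ∷ (n / 10) % 10 ∷ n % 10 ∷ []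

InA4 : ℕ → Set
InA4 n = (0 < n) × (n < 9999) × (∀ s → s ≤ 9 → n ≢ 1111 * s)

-- Sorted digits (a₀, b₀, c₀, d₀) with a₀ ≥ b₀ ≥ c₀ ≥ d₀.
-- The library sort gives the ascending order d₀ ≤ c₀ ≤ b₀ ≤ a₀
-- (the fallback branch is unreachable, digitList always has length 4).
record Sorted4 : Set where
  constructor sorted4
  field
    a₀ b₀ c₀ d₀ : ℕ

sortedDigits : ℕ → Sorted4
sortedDigits n with sort (digitList n)
... | d ∷ c ∷ b ∷ a ∷ [] = sorted4 a b c d
... | _ = sorted4 0 0 0 0

p : ℕ → ℕ × ℕ
p n = let open Sorted4 (sortedDigits n) in (a₀ ∸ d₀ , b₀ ∸ c₀)

K : ℕ → ℕ
K n = let open Sorted4 (sortedDigits n) in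
      digits→ℕ a₀ b₀ c₀ d₀ ∸ digits→ℕ d₀ c₀ b₀ a₀

-- K(n) = X − Y only depends on the parameters of n: with α = a₀ − d₀ and β = b₀ − c₀
-- one has K(n) = 999 α + 90 β.  The parameters satisfy 0 ≤ β ≤ α ≤ 9, so the theorem
-- reduces to computing p(999 α + 90 β) for the 55 possible pairs (α, β).
module Submission where

open import Defs
open import Data.Nat using (ℕ; _+_; _*_; _∸_; _≤_; _<_; z≤n; s≤s)
open import Data.Nat.DivMod using (_/_; m%n<n)
open import Data.Nat.Properties
  using (≤-decTotalOrder; ≤-trans; ∸-mono; m∸n≤m; m+n∸n≡m; m+n∸m≡n; m≤n⇒∃[o]m+o≡n; _≟_; _≤?_; _<?_; allUpTo?)
open import Data.Nat.Solver using (module +-*-Solver)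
open import Data.List using ([]; _∷_)
open import Data.List.Relation.Unary.All using (All; []; _∷_)
open import Data.List.Relation.Unary.Linked using ([-]; _∷_)
open import Data.List.Relation.Binary.Permutation.Propositional using (↭-sym)
open import Data.List.Relation.Binary.Permutation.Propositional.Properties using (All-resp-↭)
open import Data.List.Sort.InsertionSort ≤-decTotalOrder using (sort)
open import Data.List.Sort.InsertionSort.Properties ≤-decTotalOrder using (sort-↭; sort-↗)
open import Data.Product using (_×_; _,_; proj₁; proj₂)
open import Data.Unit using (tt)
open import Function using (_∘_)
open import Relation.Nullary using (Dec)
open import Relation.Nullary.Decidable using (toWitness) renaming (_×-dec_ to _&_; _→-dec_ to _⇒_)
open import Relation.Binary.PropositionalEquality using (_≡_; refl; sym; cong; cong₂; subst; module ≡-Reasoning)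

digitList-digits : ∀ n → All (_< 10) (digitList n)
digitList-digits n = m%n<n (n / 1000) 10 ∷ m%n<n (n / 100) 10 ∷ m%n<n (n / 10) 10 ∷ m%n<n n 10 ∷ []

record DescendingDigits (s : Sorted4) : Set where
  open Sorted4 s
  field
    d≤c : d₀ ≤ c₀
    c≤b : c₀ ≤ b₀
    b≤a : b₀ ≤ a₀
    a≤9 : a₀ ≤ 9

  d≤a : d₀ ≤ a₀
  d≤a = ≤-trans d≤c (≤-trans c≤b b≤a)

descending-0000 : DescendingDigits (sorted4 0 0 0 0)
descending-0000 = record { d≤c = z≤n ; c≤b = z≤n ; b≤a = z≤n ; a≤9 = z≤n }

sortedDigits-descending : ∀ n → DescendingDigits (sortedDigits n)
sortedDigits-descending n
  with sort (digitList n) | sort-↗ (digitList n)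
     | All-resp-↭ (↭-sym (sort-↭ (digitList n))) (digitList-digits n)
... | d ∷ c ∷ b ∷ a ∷ [] | d≤c ∷ c≤b ∷ b≤a ∷ [-] | _ ∷ _ ∷ _ ∷ s≤s a≤9 ∷ [] =
  record { d≤c = d≤c ; c≤b = c≤b ; b≤a = b≤a ; a≤9 = a≤9 }
... | [] | _ | _ = descending-0000
... | _ ∷ [] | _ | _ = descending-0000
... | _ ∷ _ ∷ [] | _ | _ = descending-0000
... | _ ∷ _ ∷ _ ∷ [] | _ | _ = descending-0000
... | _ ∷ _ ∷ _ ∷ _ ∷ _ ∷ _ | _ | _ = descending-0000

digits→ℕ-minus-reverse : ∀ {a b c d} → d ≤ a → c ≤ b →
  digits→ℕ a b c d ∸ digits→ℕ d c b a ≡ 999 * (a ∸ d) + 90 * (b ∸ c)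
digits→ℕ-minus-reverse {c = c} {d = d} d≤a c≤b
  with x , refl ← m≤n⇒∃[o]m+o≡n d≤a | y , refl ← m≤n⇒∃[o]m+o≡n c≤b = begin
    digits→ℕ (d + x) (c + y) c d ∸ digits→ℕ d c (c + y) (d + x)
      ≡⟨ cong (_∸ digits→ℕ d c (c + y) (d + x)) (difference-identity x y c d) ⟩
    999 * x + 90 * y + digits→ℕ d c (c + y) (d + x) ∸ digits→ℕ d c (c + y) (d + x)
      ≡⟨ m+n∸n≡m (999 * x + 90 * y) (digits→ℕ d c (c + y) (d + x)) ⟩
    999 * x + 90 * y
      ≡⟨ cong₂ (λ u v → 999 * u + 90 * v) (sym (m+n∸m≡n d x)) (sym (m+n∸m≡n c y)) ⟩
    999 * (d + x ∸ d) + 90 * (c + y ∸ c) ∎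
  where
  open ≡-Reasoning
  open +-*-Solver
  difference-identity : ∀ x y c d →
    digits→ℕ (d + x) (c + y) c d ≡ 999 * x + 90 * y + digits→ℕ d c (c + y) (d + x)
  difference-identity = solve 4 (λ x y c d →
    (d :+ x) :* con 1000 :+ (c :+ y) :* con 100 :+ c :* con 10 :+ d
      := con 999 :* x :+ con 90 :* y
         :+ (d :* con 1000 :+ c :* con 100 :+ (c :+ y) :* con 10 :+ (d :+ x))) refl

K≡999α+90β : ∀ n → K n ≡ 999 * proj₁ (p n) + 90 * proj₂ (p n)
K≡999α+90β n = digits→ℕ-minus-reverse d≤a c≤b
  where open DescendingDigits (sortedDigits-descending n)

parameters-bounded : ∀ n → proj₂ (p n) ≤ proj₁ (p n) × proj₁ (p n) ≤ 9
parameters-bounded n = ∸-mono b≤a d≤c , ≤-trans (m∸n≤m a₀ d₀) a≤9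
  where open Sorted4 (sortedDigits n); open DescendingDigits (sortedDigits-descending n)

TransitionTable : ℕ → ℕ → ℕ × ℕ → Set
TransitionTable α β (α′ , β′) =
  (1 ≤ β →
    ((β + 1 ≤ α → 5 ≤ β → (α′ ≡ 2 * α ∸ 10 × β′ ≡ 2 * β ∸ 10))
    × (6 ≤ α → β ≤ 5 → 11 ≤ α + β → (α′ ≡ 2 * α ∸ 10 × β′ ≡ 10 ∸ 2 * β))
    × (5 ≤ α → α + β ≤ 9 → (α′ ≡ 10 ∸ 2 * β × β′ ≡ 2 * α ∸ 10))
    × (α ≤ 5 → β + 1 ≤ α → (α′ ≡ 10 ∸ 2 * β × β′ ≡ 10 ∸ 2 * α))
    × (α ≤ β + 1 → 11 ≤ α + β → (α′ ≡ α + β ∸ 9 × β′ ≡ α + β ∸ 11))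
    × (5 ≤ α → 5 ≤ β → α + β ≤ 11 → (α′ ≡ α + β ∸ 9 × β′ ≡ 11 ∸ (α + β)))
    × (α ≤ 5 → β ≤ 5 → 9 ≤ α + β → (α′ ≡ 11 ∸ (α + β) × β′ ≡ α + β ∸ 9))
    × (β ≤ α → α ≤ β + 1 → α + β ≤ 9 → (α′ ≡ 11 ∸ (α + β) × β′ ≡ 9 ∸ (α + β)))
    × (β + 1 ≤ α → 9 ≤ α + β → α + β ≤ 11 → (α′ ≡ α ∸ β + 1 × β′ ≡ α ∸ β ∸ 1))
    × (5 ≤ α → β ≤ 5 → β ≤ α → α ≤ β + 1 → (α′ ≡ α ∸ β + 1 × β′ ≡ 1 + β ∸ α))
    × (α ≡ 5 → β ≡ 5 → (α′ ≡ 1 + β ∸ α × β′ ≡ α ∸ β + 1))))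
  × (β ≡ 0 →
    ((6 ≤ α → α ≤ 9 → (α′ ≡ α ∸ 1 × β′ ≡ 10 ∸ α))
    × (0 < α → α ≤ 5 → (α′ ≡ 10 ∸ α × β′ ≡ α ∸ 1))))

transitionTable? : ∀ α β q → Dec (TransitionTable α β q)
transitionTable? α β (α′ , β′) =
  (1 ≤? β ⇒
    ((β + 1 ≤? α ⇒ 5 ≤? β ⇒ (α′ ≟ 2 * α ∸ 10 & β′ ≟ 2 * β ∸ 10))
    & (6 ≤? α ⇒ β ≤? 5 ⇒ 11 ≤? α + β ⇒ (α′ ≟ 2 * α ∸ 10 & β′ ≟ 10 ∸ 2 * β))
    & (5 ≤? α ⇒ α + β ≤? 9 ⇒ (α′ ≟ 10 ∸ 2 * β & β′ ≟ 2 * α ∸ 10))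
    & (α ≤? 5 ⇒ β + 1 ≤? α ⇒ (α′ ≟ 10 ∸ 2 * β & β′ ≟ 10 ∸ 2 * α))
    & (α ≤? β + 1 ⇒ 11 ≤? α + β ⇒ (α′ ≟ α + β ∸ 9 & β′ ≟ α + β ∸ 11))
    & (5 ≤? α ⇒ 5 ≤? β ⇒ α + β ≤? 11 ⇒ (α′ ≟ α + β ∸ 9 & β′ ≟ 11 ∸ (α + β)))
    & (α ≤? 5 ⇒ β ≤? 5 ⇒ 9 ≤? α + β ⇒ (α′ ≟ 11 ∸ (α + β) & β′ ≟ α + β ∸ 9))
    & (β ≤? α ⇒ α ≤? β + 1 ⇒ α + β ≤? 9 ⇒ (α′ ≟ 11 ∸ (α + β) & β′ ≟ 9 ∸ (α + β)))
    & (β + 1 ≤? α ⇒ 9 ≤? α + β ⇒ α + β ≤? 11 ⇒ (α′ ≟ α ∸ β + 1 & β′ ≟ α ∸ β ∸ 1))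
    & (5 ≤? α ⇒ β ≤? 5 ⇒ β ≤? α ⇒ α ≤? β + 1 ⇒ (α′ ≟ α ∸ β + 1 & β′ ≟ 1 + β ∸ α))
    & (α ≟ 5 ⇒ β ≟ 5 ⇒ (α′ ≟ 1 + β ∸ α & β′ ≟ α ∸ β + 1))))
  & (β ≟ 0 ⇒
    ((6 ≤? α ⇒ α ≤? 9 ⇒ (α′ ≟ α ∸ 1 & β′ ≟ 10 ∸ α))
    & (0 <? α ⇒ α ≤? 5 ⇒ (α′ ≟ 10 ∸ α & β′ ≟ α ∸ 1))))

transitionTable-999α+90β : ∀ α β → β ≤ α → α ≤ 9 →
  TransitionTable α β (p (999 * α + 90 * β))
transitionTable-999α+90β α β β≤α α≤9 = toWitness {a? = allPairs?} tt (s≤s α≤9) (s≤s β≤α)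
  where
  allPairs? : Dec (∀ {α} → α < 10 → ∀ {β} → β < 1 + α → TransitionTable α β (p (999 * α + 90 * β)))
  allPairs? = allUpTo? (λ α → allUpTo? (λ β → transitionTable? α β (p (999 * α + 90 * β))) (1 + α)) 10

mainTheorem3 : ∀ (n : ℕ) → InA4 n →
    let α = proj₁ (p n)
        β = proj₂ (p n)
        α′ = proj₁ (p (K n))
        β′ = proj₂ (p (K n))
    in (1 ≤ β →
         -- (K1)
         ((β + 1 ≤ α → 5 ≤ β → (α′ ≡ 2 * α ∸ 10 × β′ ≡ 2 * β ∸ 10))
         -- (K2)
         × (6 ≤ α → β ≤ 5 → 11 ≤ α + β → (α′ ≡ 2 * α ∸ 10 × β′ ≡ 10 ∸ 2 * β))
         -- (K5)
         × (5 ≤ α → α + β ≤ 9 → (α′ ≡ 10 ∸ 2 * β × β′ ≡ 2 * α ∸ 10))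
         -- (K6)
         × (α ≤ 5 → β + 1 ≤ α → (α′ ≡ 10 ∸ 2 * β × β′ ≡ 10 ∸ 2 * α))
         -- (K9)
         × (α ≤ β + 1 → 11 ≤ α + β → (α′ ≡ α + β ∸ 9 × β′ ≡ α + β ∸ 11))
         -- (K10)
         × (5 ≤ α → 5 ≤ β → α + β ≤ 11 → (α′ ≡ α + β ∸ 9 × β′ ≡ 11 ∸ (α + β)))
         -- (K13)
         × (α ≤ 5 → β ≤ 5 → 9 ≤ α + β → (α′ ≡ 11 ∸ (α + β) × β′ ≡ α + β ∸ 9))
         -- (K14)
         × (β ≤ α → α ≤ β + 1 → α + β ≤ 9 → (α′ ≡ 11 ∸ (α + β) × β′ ≡ 9 ∸ (α + β)))
         -- (K17)
         × (β + 1 ≤ α → 9 ≤ α + β → α + β ≤ 11 → (α′ ≡ α ∸ β + 1 × β′ ≡ α ∸ β ∸ 1))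
         -- (K18)
         × (5 ≤ α → β ≤ 5 → β ≤ α → α ≤ β + 1 → (α′ ≡ α ∸ β + 1 × β′ ≡ 1 + β ∸ α))
         -- (K21)
         × (α ≡ 5 → β ≡ 5 → (α′ ≡ 1 + β ∸ α × β′ ≡ α ∸ β + 1))))
       × (β ≡ 0 →
         -- (K25)
         ((6 ≤ α → α ≤ 9 → (α′ ≡ α ∸ 1 × β′ ≡ 10 ∸ α))
         -- (K26)
         × (0 < α → α ≤ 5 → (α′ ≡ 10 ∸ α × β′ ≡ α ∸ 1))))
mainTheorem3 n _ with β≤α , α≤9 ← parameters-bounded n =
  subst (TransitionTable (proj₁ (p n)) (proj₂ (p n)) ∘ p) (sym (K≡999α+90β n))
    (transitionTable-999α+90β (proj₁ (p n)) (proj₂ (p n)) β≤α α≤9)
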